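{- (a) The set $\mathcal{SD}_n$ of all complex $2n\times 2n$ matrices of the form $[A,B;B^\top,A^\top]$ with $A,B$ complex $n\times n$ circulant matrices is closed under matrix addition, matrix multiplication and conjugate transpose (i.e. it is a matrix $*$-algebra). (b) The set $\mathcal{PD}_n$ of all complex $2n\times 2n$ matrices of the form $[A,B;B^\top,A^\top]$ with $A,B$ complex $n\times n$ negacirculant matrices is likewise a matrix $*$-algebra.
   Context: $[A,B;C,D]$ denotes the $2\times 2$ block matrix with top row $[A,B]$ and bottom row $[C,D]$. An $n\times n$ matrix $C$ is circulant if $C_{i,j}$ depends only on $(j-i)\bmod n$; it is negacirculant if there is $v=(v_0,\dots,v_{n-1})$ with $C_{i,j}=v_{j-i}$ for $j\ge i$ and $C_{i,j}=-v_{n+j-i}$ for $j<i$ (indices $0,\dots,n-1$). -}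

module Defs where

open import Level using (Level; _⊔_)
open import Algebra.Bundles using (CommutativeRing)
open import Data.Nat as ℕ using (ℕ; _∸_; _≤_)
open import Data.Fin using (Fin; toℕ; splitAt)
open import Data.Sum using (_⊎_; inj₁; inj₂)
open import Data.Product using (∃; ∃₂; _×_; _,_)
open import Relation.Nullary using (¬_)
import Algebra.Properties.Monoid.Sum as MonoidSum

-- A commutative ring with an involutive conjugation (ring automorphism).
-- The complex numbers with complex conjugation are the intended instance.
record StarCommRing (c ℓ : Level) : Set (Level.suc (c ⊔ ℓ)) where
  field
    commRing : CommutativeRing c ℓ
  open CommutativeRing commRing public
  field
    conj            : Carrier → Carrier
    conj-cong       : ∀ {x y} → x ≈ y → conj x ≈ conj y
    conj-+          : ∀ x y → conj (x + y) ≈ conj x + conj y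
    conj-*          : ∀ x y → conj (x * y) ≈ conj x * conj y
    conj-1          : conj 1# ≈ 1#
    conj-involutive : ∀ x → conj (conj x) ≈ x

module Matrices {c ℓ} (R : StarCommRing c ℓ) where
  open StarCommRing R
  open MonoidSum +-monoid using (sum)

  Mat : ℕ → ℕ → Set c
  Mat m n = Fin m → Fin n → Carrier

  _≈ₘ_ : ∀ {m n} → Mat m n → Mat m n → Set ℓ
  M ≈ₘ N = ∀ i j → M i j ≈ N i j

  _+ₘ_ : ∀ {m n} → Mat m n → Mat m n → Mat m n
  (M +ₘ N) i j = M i j + N i j

  _*ₘ_ : ∀ {m k n} → Mat m k → Mat k n → Mat m n
  _*ₘ_ {k = k} M N i j = sum {k} (λ l → M i l * N l j)

  transpose : ∀ {m n} → Mat m n → Mat n m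
  transpose M i j = M j i

  conjT : ∀ {m n} → Mat m n → Mat n m
  conjT M i j = conj (M j i)

  block : ∀ {n} → Mat n n → Mat n n → Mat n n → Mat n n → Mat (n ℕ.+ n) (n ℕ.+ n)
  block {n} A B C D i j with splitAt n i | splitAt n j
  ... | inj₁ i' | inj₁ j' = A i' j'
  ... | inj₁ i' | inj₂ j' = B i' j'
  ... | inj₂ i' | inj₁ j' = C i' j'
  ... | inj₂ i' | inj₂ j' = D i' j'

  -- circulant: C i j = v ((j - i) mod n)
  -- (v indexed by ℕ; only the values v 0 … v (n-1) matter)
  IsCirculant : ∀ {n} → Mat n n → Set (c ⊔ ℓ)
  IsCirculant {n} C = ∃ λ (v : ℕ → Carrier) → ∀ i j →
    (toℕ i ≤ toℕ j → C i j ≈ v (toℕ j ∸ toℕ i)) ×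
    (¬ (toℕ i ≤ toℕ j) → C i j ≈ v (n ℕ.+ toℕ j ∸ toℕ i))

  IsNegacirculant : ∀ {n} → Mat n n → Set (c ⊔ ℓ)
  IsNegacirculant {n} C = ∃ λ (v : ℕ → Carrier) → ∀ i j →
    (toℕ i ≤ toℕ j → C i j ≈ v (toℕ j ∸ toℕ i)) ×
    (¬ (toℕ i ≤ toℕ j) → C i j ≈ - v (n ℕ.+ toℕ j ∸ toℕ i))

  InSD : ∀ n → Mat (n ℕ.+ n) (n ℕ.+ n) → Set (c ⊔ ℓ)
  InSD n M = ∃₂ λ (A B : Mat n n) → IsCirculant A × IsCirculant B ×
    (M ≈ₘ block A B (transpose B) (transpose A))

  InPD : ∀ n → Mat (n ℕ.+ n) (n ℕ.+ n) → Set (c ⊔ ℓ)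
  InPD n M = ∃₂ λ (A B : Mat n n) → IsNegacirculant A × IsNegacirculant B ×
    (M ≈ₘ block A B (transpose B) (transpose A))

  IsStarClosed : ∀ {m} → (Mat m m → Set (c ⊔ ℓ)) → Set (c ⊔ ℓ)
  IsStarClosed P = ∀ M N → P M → P N →
    P (M +ₘ N) × P (M *ₘ N) × P (conjT M)

{-# OPTIONS --safe #-}

-- Let 𝒞 be a class of n×n matrices closed under +, *, transpose and conjugate transpose, any two
-- of which commute. Multiplying blocks, [A,B;Bᵀ,Aᵀ][C,D;Dᵀ,Cᵀ] has upper blocks X = AC + BDᵀ,
-- Y = AD + BCᵀ in 𝒞 and lower blocks BᵀC + AᵀDᵀ = (AD + BCᵀ)ᵀ and BᵀD + AᵀCᵀ = (AC + BDᵀ)ᵀ by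
-- commutativity, so the product is [X,Y;Yᵀ,Xᵀ]; sums and conjugate transposes are blockwise.
--
-- Circulant (ε = 1) and negacirculant (ε = -1) matrices form such classes. They are exactly the
-- matrices invariant under conjugation by the ε-twisted cyclic shift, a condition visibly stable
-- under the algebra operations (for products because ε² = 1). They are also persymmetric, and
-- if A, B and AB are persymmetric then reversing the summation index turns AB into BA.

module Submission where

open import Defs
open import Level using (Level; _⊔_)
open import Data.Nat as ℕ using (ℕ; zero; suc; _∸_; _≤_; _<_; _≤?_; _<?_; s≤s)
import Data.Nat.Properties as ℕP
open import Data.Fin as Fin using (Fin; toℕ; fromℕ; fromℕ<; inject₁; opposite; _↑ˡ_; _↑ʳ_; splitAt)
open import Data.Fin.Properties as FinP using (toℕ-inject₁; toℕ-fromℕ; opposite-prop; opposite-involutive)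
open import Data.Fin.Induction using (<-weakInduction)
open import Data.Fin.Permutation using (reverse)
open import Data.Product using (_×_; ∃; ∃₂; _,_; proj₁; proj₂)
open import Data.Sum using (inj₁; inj₂)
open import Function using (id; _∘_)
open import Relation.Nullary using (¬_; yes; no)
open import Relation.Nullary.Negation using (contradiction)
open import Relation.Binary.PropositionalEquality as ≡ using (_≡_)
import Algebra.Properties.Semiring.Sum as SemiringSum
import Algebra.Properties.Group as GroupProperties
import Algebra.Properties.Ring as RingProperties
import Relation.Binary.Reasoning.Setoid as SetoidReasoning
import Algebra.Solver.CommutativeMonoid

m∸a≡[m∸b]+[b∸a] : ∀ {a b m} → a ≤ b → b ≤ m → m ∸ a ≡ (m ∸ b) ℕ.+ (b ∸ a)
m∸a≡[m∸b]+[b∸a] {a} {b} {m} a≤b b≤m =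
  ≡.trans (≡.cong (_∸ a) (≡.sym (ℕP.m∸n+n≡m b≤m))) (ℕP.+-∸-assoc (m ∸ b) a≤b)

n+b∸a≡n∸[a∸b] : ∀ n {a b} → b ≤ a → n ℕ.+ b ∸ a ≡ n ∸ (a ∸ b)
n+b∸a≡n∸[a∸b] n {a} {b} b≤a = begin
  n ℕ.+ b ∸ a                  ≡⟨ ≡.cong (n ℕ.+ b ∸_) (≡.sym (ℕP.m+[n∸m]≡n b≤a)) ⟩
  n ℕ.+ b ∸ (b ℕ.+ (a ∸ b))    ≡⟨ ≡.sym (ℕP.∸-+-assoc (n ℕ.+ b) b (a ∸ b)) ⟩
  n ℕ.+ b ∸ b ∸ (a ∸ b)        ≡⟨ ≡.cong (_∸ (a ∸ b)) (ℕP.m+n∸n≡m n b) ⟩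
  n ∸ (a ∸ b)                  ∎
  where open ≡.≡-Reasoning

[m∸a]∸[m∸b]≡b∸a : ∀ {a b m} → a ≤ b → b ≤ m → (m ∸ a) ∸ (m ∸ b) ≡ b ∸ a
[m∸a]∸[m∸b]≡b∸a {a} {b} {m} a≤b b≤m =
  ≡.trans (≡.cong (_∸ (m ∸ b)) (m∸a≡[m∸b]+[b∸a] a≤b b≤m)) (ℕP.m+n∸m≡n (m ∸ b) (b ∸ a))

n+[m∸a]∸[m∸b]≡n+b∸a : ∀ n {a b m} → b ≤ a → a ≤ m → n ℕ.+ (m ∸ a) ∸ (m ∸ b) ≡ n ℕ.+ b ∸ a
n+[m∸a]∸[m∸b]≡n+b∸a n {a} {b} {m} b≤a a≤m = begin
  n ℕ.+ (m ∸ a) ∸ (m ∸ b)                 ≡⟨ ≡.cong (n ℕ.+ (m ∸ a) ∸_) (m∸a≡[m∸b]+[b∸a] b≤a a≤m) ⟩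
  n ℕ.+ (m ∸ a) ∸ ((m ∸ a) ℕ.+ (a ∸ b))   ≡⟨ ≡.cong (_∸ ((m ∸ a) ℕ.+ (a ∸ b))) (ℕP.+-comm n (m ∸ a)) ⟩
  (m ∸ a) ℕ.+ n ∸ ((m ∸ a) ℕ.+ (a ∸ b))   ≡⟨ ℕP.[m+n]∸[m+o]≡n∸o (m ∸ a) n (a ∸ b) ⟩
  n ∸ (a ∸ b)                             ≡⟨ ≡.sym (n+b∸a≡n∸[a∸b] n b≤a) ⟩
  n ℕ.+ b ∸ a                             ∎
  where open ≡.≡-Reasoning

cyclicPred : ∀ {m} → Fin (suc m) → Fin (suc m)
cyclicPred {m} Fin.zero = fromℕ m
cyclicPred (Fin.suc i)  = inject₁ i

module StarMatrices {c ℓ} (R : StarCommRing c ℓ) where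
  open StarCommRing R
  open Matrices R
  open SemiringSum semiring using (sum; sum-cong-≋; sum-init-last; sum-permute; *-distribˡ-sum)
  open SetoidReasoning setoid

  private
    module +-Group = GroupProperties +-group

  conj-0# : conj 0# ≈ 0#
  conj-0# = +-Group.identityˡ-unique (conj 0#) (conj 0#)
    (trans (sym (conj-+ 0# 0#)) (conj-cong (+-identityˡ 0#)))

  conj-neg : ∀ x → conj (- x) ≈ - conj x
  conj-neg x = +-Group.inverseˡ-unique (conj (- x)) (conj x)
    (trans (sym (conj-+ (- x) x)) (trans (conj-cong (-‿inverseˡ x)) conj-0#))

  *-cancel-middle : ∀ {u} a b x y → u * u ≈ 1# → ((a * u) * x) * ((u * b) * y) ≈ (a * b) * (x * y)
  *-cancel-middle {u} a b x y u²≈1 = begin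
    ((a * u) * x) * ((u * b) * y)   ≈⟨ *-Solver.solve 5 (λ a b u x y →
                                         ((a ⊕ u) ⊕ x) ⊕ ((u ⊕ b) ⊕ y) ⊜ (a ⊕ b) ⊕ ((u ⊕ u) ⊕ (x ⊕ y)))
                                         refl a b u x y ⟩
    (a * b) * ((u * u) * (x * y))   ≈⟨ *-congˡ (trans (*-congʳ u²≈1) (*-identityˡ (x * y))) ⟩
    (a * b) * (x * y)               ∎
    where
    module *-Solver = Algebra.Solver.CommutativeMonoid *-commutativeMonoid
    open *-Solver using (_⊕_; _⊜_)

  sum-split : ∀ a {b} (f : Fin (a ℕ.+ b) → Carrier) →
              sum f ≈ sum (λ l → f (l ↑ˡ b)) + sum (λ l → f (a ↑ʳ l))
  sum-split zero f = sym (+-identityˡ _)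
  sum-split (suc a) {b} f = trans (+-congˡ (sum-split a (f ∘ Fin.suc))) (sym (+-assoc _ _ _))

  sum-cyclicPred : ∀ {m} (f : Fin (suc m) → Carrier) → sum (f ∘ cyclicPred) ≈ sum f
  sum-cyclicPred f = trans (+-comm _ _) (sym (sum-init-last f))

  sum-opposite : ∀ {n} (f : Fin n → Carrier) → sum (f ∘ opposite) ≈ sum f
  sum-opposite f = sym (sum-permute f reverse)

  +ₘ-cong : ∀ {m n} {A A′ B B′ : Mat m n} → A ≈ₘ A′ → B ≈ₘ B′ → (A +ₘ B) ≈ₘ (A′ +ₘ B′)
  +ₘ-cong A≈ B≈ i j = +-cong (A≈ i j) (B≈ i j)

  *ₘ-cong : ∀ {m k n} {A A′ : Mat m k} {B B′ : Mat k n} →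
            A ≈ₘ A′ → B ≈ₘ B′ → (A *ₘ B) ≈ₘ (A′ *ₘ B′)
  *ₘ-cong A≈ B≈ i j = sum-cong-≋ (λ l → *-cong (A≈ i l) (B≈ l j))

  conjT-cong : ∀ {m n} {A A′ : Mat m n} → A ≈ₘ A′ → conjT A ≈ₘ conjT A′
  conjT-cong A≈ i j = conj-cong (A≈ j i)

  transpose-*ₘ : ∀ {m k n} (A : Mat m k) (B : Mat k n) →
                 transpose (A *ₘ B) ≈ₘ (transpose B *ₘ transpose A)
  transpose-*ₘ A B i j = sum-cong-≋ (λ l → *-comm (A j l) (B l i))

  IsPersymmetric : ∀ {n} → Mat n n → Set ℓ
  IsPersymmetric A = ∀ i j → A i j ≈ A (opposite j) (opposite i)

  persymmetric-resp : ∀ {n} {A B : Mat n n} → A ≈ₘ B → IsPersymmetric B → IsPersymmetric A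
  persymmetric-resp A≈B pB i j = trans (A≈B i j) (trans (pB i j) (sym (A≈B _ _)))

  persymmetric-*ₘ-comm : ∀ {n} {A B : Mat n n} → IsPersymmetric A → IsPersymmetric B →
                         IsPersymmetric (A *ₘ B) → (A *ₘ B) ≈ₘ (B *ₘ A)
  persymmetric-*ₘ-comm {A = A} {B} pA pB pAB i j = begin
    (A *ₘ B) i j                                        ≈⟨ pAB i j ⟩
    sum (λ l → A (opposite j) l * B l (opposite i))     ≈⟨ sum-cong-≋ swap ⟩
    sum (λ l → B i (opposite l) * A (opposite l) j)     ≈⟨ sum-opposite (λ l → B i l * A l j) ⟩
    (B *ₘ A) i j                                        ∎
    where
    swap : ∀ l → A (opposite j) l * B l (opposite i) ≈ B i (opposite l) * A (opposite l) j
    swap l = trans (*-comm _ _) (*-cong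
      (trans (pB l (opposite i)) (reflexive (≡.cong (λ x → B x (opposite l)) (opposite-involutive i))))
      (trans (pA (opposite j) l) (reflexive (≡.cong (A (opposite l)) (opposite-involutive j)))))

  module _ {n : ℕ} where
    block-topLeft : ∀ (A B C D : Mat n n) i j → block A B C D (i ↑ˡ n) (j ↑ˡ n) ≡ A i j
    block-topLeft A B C D i j rewrite FinP.splitAt-↑ˡ n i n | FinP.splitAt-↑ˡ n j n = ≡.refl

    block-topRight : ∀ (A B C D : Mat n n) i j → block A B C D (i ↑ˡ n) (n ↑ʳ j) ≡ B i j
    block-topRight A B C D i j rewrite FinP.splitAt-↑ˡ n i n | FinP.splitAt-↑ʳ n n j = ≡.refl

    block-bottomLeft : ∀ (A B C D : Mat n n) i j → block A B C D (n ↑ʳ i) (j ↑ˡ n) ≡ C i j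
    block-bottomLeft A B C D i j rewrite FinP.splitAt-↑ʳ n n i | FinP.splitAt-↑ˡ n j n = ≡.refl

    block-bottomRight : ∀ (A B C D : Mat n n) i j → block A B C D (n ↑ʳ i) (n ↑ʳ j) ≡ D i j
    block-bottomRight A B C D i j rewrite FinP.splitAt-↑ʳ n n i | FinP.splitAt-↑ʳ n n j = ≡.refl

    ≈ₘ-block : ∀ (X : Mat (n ℕ.+ n) (n ℕ.+ n)) {A B C D : Mat n n} →
      (∀ i j → X (i ↑ˡ n) (j ↑ˡ n) ≈ A i j) → (∀ i j → X (i ↑ˡ n) (n ↑ʳ j) ≈ B i j) →
      (∀ i j → X (n ↑ʳ i) (j ↑ˡ n) ≈ C i j) → (∀ i j → X (n ↑ʳ i) (n ↑ʳ j) ≈ D i j) →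
      X ≈ₘ block A B C D
    ≈ₘ-block X X₁₁ X₁₂ X₂₁ X₂₂ i j with splitAt n i in i≡ | splitAt n j in j≡
    ... | inj₁ i′ | inj₁ j′ with ≡.refl ← FinP.splitAt⁻¹-↑ˡ i≡ | ≡.refl ← FinP.splitAt⁻¹-↑ˡ j≡ = X₁₁ i′ j′
    ... | inj₁ i′ | inj₂ j′ with ≡.refl ← FinP.splitAt⁻¹-↑ˡ i≡ | ≡.refl ← FinP.splitAt⁻¹-↑ʳ j≡ = X₁₂ i′ j′
    ... | inj₂ i′ | inj₁ j′ with ≡.refl ← FinP.splitAt⁻¹-↑ʳ i≡ | ≡.refl ← FinP.splitAt⁻¹-↑ˡ j≡ = X₂₁ i′ j′
    ... | inj₂ i′ | inj₂ j′ with ≡.refl ← FinP.splitAt⁻¹-↑ʳ i≡ | ≡.refl ← FinP.splitAt⁻¹-↑ʳ j≡ = X₂₂ i′ j′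

    block-cong : ∀ {A A′ B B′ C C′ D D′ : Mat n n} → A ≈ₘ A′ → B ≈ₘ B′ → C ≈ₘ C′ → D ≈ₘ D′ →
                 block A B C D ≈ₘ block A′ B′ C′ D′
    block-cong A≈ B≈ C≈ D≈ i j with splitAt n i | splitAt n j
    ... | inj₁ i′ | inj₁ j′ = A≈ i′ j′
    ... | inj₁ i′ | inj₂ j′ = B≈ i′ j′
    ... | inj₂ i′ | inj₁ j′ = C≈ i′ j′
    ... | inj₂ i′ | inj₂ j′ = D≈ i′ j′

    block-+ₘ : ∀ (A B C D A′ B′ C′ D′ : Mat n n) →
      (block A B C D +ₘ block A′ B′ C′ D′) ≈ₘ block (A +ₘ A′) (B +ₘ B′) (C +ₘ C′) (D +ₘ D′)
    block-+ₘ A B C D A′ B′ C′ D′ i j with splitAt n i | splitAt n j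
    ... | inj₁ _ | inj₁ _ = refl
    ... | inj₁ _ | inj₂ _ = refl
    ... | inj₂ _ | inj₁ _ = refl
    ... | inj₂ _ | inj₂ _ = refl

    conjT-block : ∀ (A B C D : Mat n n) →
      conjT (block A B C D) ≈ₘ block (conjT A) (conjT C) (conjT B) (conjT D)
    conjT-block A B C D i j with splitAt n i | splitAt n j
    ... | inj₁ _ | inj₁ _ = refl
    ... | inj₁ _ | inj₂ _ = refl
    ... | inj₂ _ | inj₁ _ = refl
    ... | inj₂ _ | inj₂ _ = refl

    block-*ₘ : ∀ (A B C D A′ B′ C′ D′ : Mat n n) →
      (block A B C D *ₘ block A′ B′ C′ D′) ≈ₘ
      block ((A *ₘ A′) +ₘ (B *ₘ C′)) ((A *ₘ B′) +ₘ (B *ₘ D′))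
            ((C *ₘ A′) +ₘ (D *ₘ C′)) ((C *ₘ B′) +ₘ (D *ₘ D′))
    block-*ₘ A B C D A′ B′ C′ D′ = ≈ₘ-block (X *ₘ Y)
      (λ i j → quadrant (block-topLeft A B C D i) (λ l → block-topLeft A′ B′ C′ D′ l j)
                        (block-topRight A B C D i) (λ l → block-bottomLeft A′ B′ C′ D′ l j))
      (λ i j → quadrant (block-topLeft A B C D i) (λ l → block-topRight A′ B′ C′ D′ l j)
                        (block-topRight A B C D i) (λ l → block-bottomRight A′ B′ C′ D′ l j))
      (λ i j → quadrant (block-bottomLeft A B C D i) (λ l → block-topLeft A′ B′ C′ D′ l j)
                        (block-bottomRight A B C D i) (λ l → block-bottomLeft A′ B′ C′ D′ l j))
      (λ i j → quadrant (block-bottomLeft A B C D i) (λ l → block-topRight A′ B′ C′ D′ l j)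
                        (block-bottomRight A B C D i) (λ l → block-bottomRight A′ B′ C′ D′ l j))
      where
      X = block A B C D
      Y = block A′ B′ C′ D′
      quadrant : ∀ {x y} {F G H K : Fin n → Carrier} →
        (∀ l → X x (l ↑ˡ n) ≡ F l) → (∀ l → Y (l ↑ˡ n) y ≡ G l) →
        (∀ l → X x (n ↑ʳ l) ≡ H l) → (∀ l → Y (n ↑ʳ l) y ≡ K l) →
        (X *ₘ Y) x y ≈ sum (λ l → F l * G l) + sum (λ l → H l * K l)
      quadrant {x} {y} XF YG XH YK = trans (sum-split n (λ l → X x l * Y l y)) (+-cong
        (sum-cong-≋ (λ l → reflexive (≡.cong₂ _*_ (XF l) (YG l))))
        (sum-cong-≋ (λ l → reflexive (≡.cong₂ _*_ (XH l) (YK l)))))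

  record IsCommutingStarClass {n p} (P : Mat n n → Set p) : Set (c ⊔ ℓ ⊔ p) where
    field
      +-closed         : ∀ {A B} → P A → P B → P (A +ₘ B)
      *-closed         : ∀ {A B} → P A → P B → P (A *ₘ B)
      transpose-closed : ∀ {A} → P A → P (transpose A)
      conjT-closed     : ∀ {A} → P A → P (conjT A)
      *ₘ-comm          : ∀ {A B} → P A → P B → (A *ₘ B) ≈ₘ (B *ₘ A)

  commutingStarClass-⇔ : ∀ {n p q} {P : Mat n n → Set p} {Q : Mat n n → Set q} →
    (∀ {A} → P A → Q A) → (∀ {A} → Q A → P A) → IsCommutingStarClass P → IsCommutingStarClass Q
  commutingStarClass-⇔ P⇒Q Q⇒P cls = record
    { +-closed         = λ qA qB → P⇒Q (+-closed (Q⇒P qA) (Q⇒P qB))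
    ; *-closed         = λ qA qB → P⇒Q (*-closed (Q⇒P qA) (Q⇒P qB))
    ; transpose-closed = P⇒Q ∘ transpose-closed ∘ Q⇒P
    ; conjT-closed     = P⇒Q ∘ conjT-closed ∘ Q⇒P
    ; *ₘ-comm          = λ qA qB → *ₘ-comm (Q⇒P qA) (Q⇒P qB)
    }
    where open IsCommutingStarClass cls

  InBlockForm : ∀ {n} → (Mat n n → Set (c ⊔ ℓ)) → Mat (n ℕ.+ n) (n ℕ.+ n) → Set (c ⊔ ℓ)
  InBlockForm {n} P M = ∃₂ λ (A B : Mat n n) → P A × P B × (M ≈ₘ block A B (transpose B) (transpose A))

  module _ {n} {P : Mat n n → Set (c ⊔ ℓ)} (cls : IsCommutingStarClass P) where
    open IsCommutingStarClass cls

    transpose-block-product : ∀ {A B C D} → P A → P B → P C → P D →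
      ((transpose B *ₘ C) +ₘ (transpose A *ₘ transpose D)) ≈ₘ transpose ((A *ₘ D) +ₘ (B *ₘ transpose C))
    transpose-block-product {A} {B} {C} {D} pA pB pC pD i j = begin
      (transpose B *ₘ C) i j + (transpose A *ₘ transpose D) i j
        ≈⟨ +-cong (*ₘ-comm (transpose-closed pB) pC i j)
                  (*ₘ-comm (transpose-closed pA) (transpose-closed pD) i j) ⟩
      (C *ₘ transpose B) i j + (transpose D *ₘ transpose A) i j
        ≈⟨ +-comm _ _ ⟩
      (transpose D *ₘ transpose A) i j + (C *ₘ transpose B) i j
        ≈⟨ sym (+-cong (transpose-*ₘ A D i j) (transpose-*ₘ B (transpose C) i j)) ⟩
      (A *ₘ D) j i + (B *ₘ transpose C) j i
        ∎

    inBlockForm-starClosed : IsStarClosed (InBlockForm P)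
    inBlockForm-starClosed M N (A , B , pA , pB , M≈) (C , D , pC , pD , N≈) =
      ( (A +ₘ C) , (B +ₘ D) , +-closed pA pC , +-closed pB pD
      , λ i j → trans (+ₘ-cong M≈ N≈ i j) (block-+ₘ A B _ _ C D _ _ i j) )
      , ( ((A *ₘ C) +ₘ (B *ₘ transpose D)) , ((A *ₘ D) +ₘ (B *ₘ transpose C))
        , +-closed (*-closed pA pC) (*-closed pB (transpose-closed pD))
        , +-closed (*-closed pA pD) (*-closed pB (transpose-closed pC))
        , λ i j → trans (*ₘ-cong M≈ N≈ i j) (trans (block-*ₘ A B _ _ C D _ _ i j)
            (block-cong (λ _ _ → refl) (λ _ _ → refl)
                        (transpose-block-product pA pB pC pD)
                        (transpose-block-product pA pB pD pC) i j)) )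
      , ( conjT A , conjT (transpose B) , conjT-closed pA , conjT-closed (transpose-closed pB)
        , λ i j → trans (conjT-cong M≈ i j) (conjT-block A B _ _ i j) )

  -- IsCirculant and IsNegacirculant are IsCirculantWith id and IsCirculantWith -_.
  IsCirculantWith : ∀ {n} → (Carrier → Carrier) → Mat n n → Set (c ⊔ ℓ)
  IsCirculantWith {n} g C = ∃ λ (v : ℕ → Carrier) → ∀ i j →
    (toℕ i ≤ toℕ j → C i j ≈ v (toℕ j ∸ toℕ i)) ×
    (¬ (toℕ i ≤ toℕ j) → C i j ≈ g (v (n ℕ.+ toℕ j ∸ toℕ i)))

  module Twisted (ε : Carrier) (ε²≈1 : ε * ε ≈ 1#) (conj-ε : conj ε ≈ ε) where

    twist : ∀ {m} → Fin (suc m) → Carrier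
    twist Fin.zero    = ε
    twist (Fin.suc _) = 1#

    twist²≈1 : ∀ {m} (i : Fin (suc m)) → twist i * twist i ≈ 1#
    twist²≈1 Fin.zero    = ε²≈1
    twist²≈1 (Fin.suc _) = *-identityˡ 1#

    conj-twist : ∀ {m} (i : Fin (suc m)) → conj (twist i) ≈ twist i
    conj-twist Fin.zero    = conj-ε
    conj-twist (Fin.suc _) = conj-1

    -- Invariance under conjugation by the ε-twisted cyclic shift: an index moved across the
    -- wrap-around costs a factor ε.
    IsShiftInvariant : ∀ {m} → Mat (suc m) (suc m) → Set ℓ
    IsShiftInvariant A = ∀ i j → A i j ≈ (twist i * twist j) * A (cyclicPred i) (cyclicPred j)

    module _ {m : ℕ} where
      shiftInvariant-resp : ∀ {A B : Mat (suc m) (suc m)} →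
                            A ≈ₘ B → IsShiftInvariant B → IsShiftInvariant A
      shiftInvariant-resp A≈B sB i j = trans (A≈B i j) (trans (sB i j) (*-congˡ (sym (A≈B _ _))))

      +ₘ-shiftInvariant : ∀ {A B : Mat (suc m) (suc m)} →
                          IsShiftInvariant A → IsShiftInvariant B → IsShiftInvariant (A +ₘ B)
      +ₘ-shiftInvariant sA sB i j = trans (+-cong (sA i j) (sB i j)) (sym (distribˡ _ _ _))

      *ₘ-shiftInvariant : ∀ {A B : Mat (suc m) (suc m)} →
                          IsShiftInvariant A → IsShiftInvariant B → IsShiftInvariant (A *ₘ B)
      *ₘ-shiftInvariant {A} {B} sA sB i j = begin
        (A *ₘ B) i j                          ≈⟨ sum-cong-≋ (λ l → trans (*-cong (sA i l) (sB l j))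
                                                   (*-cancel-middle (twist i) (twist j) _ _ (twist²≈1 l))) ⟩
        sum (λ l → w * shifted (cyclicPred l)) ≈⟨ *-distribˡ-sum w (shifted ∘ cyclicPred) ⟨
        w * sum (shifted ∘ cyclicPred)         ≈⟨ *-congˡ (sum-cyclicPred shifted) ⟩
        w * (A *ₘ B) (cyclicPred i) (cyclicPred j) ∎
        where
        w = twist i * twist j
        shifted : Fin (suc m) → Carrier
        shifted l = A (cyclicPred i) l * B l (cyclicPred j)

      transpose-shiftInvariant : ∀ {A : Mat (suc m) (suc m)} →
                                 IsShiftInvariant A → IsShiftInvariant (transpose A)
      transpose-shiftInvariant sA i j = trans (sA j i) (*-congʳ (*-comm _ _))

      conjT-shiftInvariant : ∀ {A : Mat (suc m) (suc m)} →
                             IsShiftInvariant A → IsShiftInvariant (conjT A)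
      conjT-shiftInvariant sA i j = trans (conj-cong (sA j i)) (trans (conj-* _ _) (*-congʳ (begin
        conj (twist j * twist i)        ≈⟨ conj-* (twist j) (twist i) ⟩
        conj (twist j) * conj (twist i) ≈⟨ *-cong (conj-twist j) (conj-twist i) ⟩
        twist j * twist i               ≈⟨ *-comm (twist j) (twist i) ⟩
        twist i * twist j               ∎)))

      -- Each row determines the next one.
      shiftInvariant-unique : ∀ {A B : Mat (suc m) (suc m)} →
        IsShiftInvariant A → IsShiftInvariant B → (∀ j → A Fin.zero j ≈ B Fin.zero j) → A ≈ₘ B
      shiftInvariant-unique {A} {B} sA sB row₀ = <-weakInduction (λ i → ∀ j → A i j ≈ B i j) row₀ step
        where
        step : ∀ i → (∀ j → A (inject₁ i) j ≈ B (inject₁ i) j) →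
                     ∀ j → A (Fin.suc i) j ≈ B (Fin.suc i) j
        step i rowᵢ j =
          trans (sA (Fin.suc i) j) (trans (*-congˡ (rowᵢ (cyclicPred j))) (sym (sB (Fin.suc i) j)))

    twistedEntry : ℕ → (ℕ → Carrier) → ℕ → ℕ → Carrier
    twistedEntry n v a b with a ≤? b
    ... | yes _ = v (b ∸ a)
    ... | no  _ = ε * v (n ℕ.+ b ∸ a)

    twistedCirculant : ∀ {n} → (ℕ → Carrier) → Mat n n
    twistedCirculant {n} v i j = twistedEntry n v (toℕ i) (toℕ j)

    module _ {n : ℕ} (v : ℕ → Carrier) where
      twistedEntry-≤ : ∀ {a b} → a ≤ b → twistedEntry n v a b ≡ v (b ∸ a)
      twistedEntry-≤ {a} {b} a≤b with a ≤? b
      ... | yes _   = ≡.refl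
      ... | no a≰b  = contradiction a≤b a≰b

      twistedEntry-≰ : ∀ {a b} → ¬ a ≤ b → twistedEntry n v a b ≡ ε * v (n ℕ.+ b ∸ a)
      twistedEntry-≰ {a} {b} a≰b with a ≤? b
      ... | yes a≤b = contradiction a≤b a≰b
      ... | no _    = ≡.refl

      twistedEntry-suc-suc : ∀ a b → twistedEntry n v (suc a) (suc b) ≈ twistedEntry n v a b
      twistedEntry-suc-suc a b with a ≤? b | suc a ≤? suc b
      ... | yes _   | yes _   = refl
      ... | no _    | no _    = reflexive (≡.cong (λ k → ε * v (k ∸ suc a)) (ℕP.+-suc n b))
      ... | yes a≤b | no a≰b  = contradiction (s≤s a≤b) a≰b
      ... | no a≰b  | yes a≤b = contradiction (ℕ.s≤s⁻¹ a≤b) a≰b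

    module _ {m : ℕ} (v : ℕ → Carrier) where
      twistedEntry-suc-zero : ∀ {a} → a ≤ m →
                              twistedEntry (suc m) v (suc a) 0 ≈ ε * twistedEntry (suc m) v a m
      twistedEntry-suc-zero {a} a≤m = begin
        twistedEntry (suc m) v (suc a) 0  ≡⟨ twistedEntry-≰ {suc m} v {suc a} {0} (λ ()) ⟩
        ε * v (m ℕ.+ 0 ∸ a)               ≡⟨ ≡.cong (λ k → ε * v (k ∸ a)) (ℕP.+-identityʳ m) ⟩
        ε * v (m ∸ a)                     ≡⟨ ≡.cong (ε *_) (twistedEntry-≤ {suc m} v a≤m) ⟨
        ε * twistedEntry (suc m) v a m    ∎

      twistedEntry-zero-suc : ∀ {b} → b < m →
                              twistedEntry (suc m) v 0 (suc b) ≈ ε * twistedEntry (suc m) v m b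
      twistedEntry-zero-suc {b} b<m = begin
        v (suc b)                       ≈⟨ reflexive (≡.cong v suc-m+b∸m≡suc-b) ⟨
        v (suc m ℕ.+ b ∸ m)             ≈⟨ ε-cancel ⟨
        ε * (ε * v (suc m ℕ.+ b ∸ m))   ≈⟨ *-congˡ (reflexive (twistedEntry-≰ {suc m} v (ℕP.<⇒≱ b<m))) ⟨
        ε * twistedEntry (suc m) v m b  ∎
        where
        suc-m+b∸m≡suc-b : suc m ℕ.+ b ∸ m ≡ suc b
        suc-m+b∸m≡suc-b = ≡.trans (≡.cong (_∸ m) (≡.sym (ℕP.+-suc m b))) (ℕP.m+n∸m≡n m (suc b))
        ε-cancel : ∀ {x} → ε * (ε * x) ≈ x
        ε-cancel {x} = trans (sym (*-assoc ε ε x)) (trans (*-congʳ ε²≈1) (*-identityˡ x))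

      twistedEntry-zero-zero : twistedEntry (suc m) v 0 0 ≈ (ε * ε) * twistedEntry (suc m) v m m
      twistedEntry-zero-zero = begin
        v 0                              ≈⟨ reflexive (≡.cong v (≡.sym (ℕP.n∸n≡0 m))) ⟩
        v (m ∸ m)                        ≈⟨ reflexive (twistedEntry-≤ {suc m} v {m} {m} ℕP.≤-refl) ⟨
        twistedEntry (suc m) v m m       ≈⟨ *-identityˡ _ ⟨
        1# * twistedEntry (suc m) v m m  ≈⟨ *-congʳ ε²≈1 ⟨
        (ε * ε) * twistedEntry (suc m) v m m ∎

      twistedCirculant-shiftInvariant : IsShiftInvariant (twistedCirculant {suc m} v)
      twistedCirculant-shiftInvariant (Fin.suc i) (Fin.suc j)
        rewrite toℕ-inject₁ i | toℕ-inject₁ j =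
        trans (twistedEntry-suc-suc v (toℕ i) (toℕ j))
              (sym (trans (*-congʳ (*-identityˡ 1#)) (*-identityˡ _)))
      twistedCirculant-shiftInvariant (Fin.suc i) Fin.zero
        rewrite toℕ-inject₁ i | toℕ-fromℕ m =
        trans (twistedEntry-suc-zero (ℕP.<⇒≤ (FinP.toℕ<n i))) (*-congʳ (sym (*-identityˡ ε)))
      twistedCirculant-shiftInvariant Fin.zero (Fin.suc j)
        rewrite toℕ-fromℕ m | toℕ-inject₁ j =
        trans (twistedEntry-zero-suc (FinP.toℕ<n j)) (*-congʳ (sym (*-identityʳ ε)))
      twistedCirculant-shiftInvariant Fin.zero Fin.zero
        rewrite toℕ-fromℕ m = twistedEntry-zero-zero

      twistedCirculant-persymmetric : IsPersymmetric (twistedCirculant {suc m} v)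
      twistedCirculant-persymmetric i j rewrite opposite-prop i | opposite-prop j =
        twistedEntry-persymmetric (FinP.toℕ≤pred[n] i) (FinP.toℕ≤pred[n] j)
        where
        twistedEntry-persymmetric : ∀ {a b} → a ≤ m → b ≤ m →
          twistedEntry (suc m) v a b ≈ twistedEntry (suc m) v (m ∸ b) (m ∸ a)
        twistedEntry-persymmetric {a} {b} a≤m b≤m with a ≤? b | m ∸ b ≤? m ∸ a
        ... | yes a≤b | yes _       = reflexive (≡.cong v (≡.sym ([m∸a]∸[m∸b]≡b∸a a≤b b≤m)))
        ... | yes a≤b | no m∸b≰m∸a  = contradiction (ℕP.∸-monoʳ-≤ m a≤b) m∸b≰m∸a
        ... | no a≰b  | yes m∸b≤m∸a = contradiction m∸b≤m∸a (ℕP.<⇒≱ (ℕP.∸-monoʳ-< (ℕP.≰⇒> a≰b) a≤m))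
        ... | no a≰b  | no _        = reflexive (≡.cong (λ k → ε * v k)
                                    (≡.sym (n+[m∸a]∸[m∸b]≡n+b∸a (suc m) (ℕP.<⇒≤ (ℕP.≰⇒> a≰b)) a≤m)))

    module _ {m : ℕ} where
      firstRow : Mat (suc m) (suc m) → ℕ → Carrier
      firstRow A k with k <? suc m
      ... | yes k<n = A Fin.zero (fromℕ< k<n)
      ... | no _    = 0#

      firstRow-toℕ : ∀ (A : Mat (suc m) (suc m)) j → firstRow A (toℕ j) ≈ A Fin.zero j
      firstRow-toℕ A j with toℕ j <? suc m
      ... | yes j<n = reflexive (≡.cong (A Fin.zero) (FinP.fromℕ<-toℕ j j<n))
      ... | no j≮n  = contradiction (FinP.toℕ<n j) j≮n

      shiftInvariant⇒≈twistedCirculant : ∀ {A : Mat (suc m) (suc m)} →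
        IsShiftInvariant A → A ≈ₘ twistedCirculant (firstRow A)
      shiftInvariant⇒≈twistedCirculant {A} sA = shiftInvariant-unique sA
        (twistedCirculant-shiftInvariant (firstRow A)) (λ j → sym (firstRow-toℕ A j))

      shiftInvariant-persymmetric : ∀ {A : Mat (suc m) (suc m)} → IsShiftInvariant A → IsPersymmetric A
      shiftInvariant-persymmetric sA =
        persymmetric-resp (shiftInvariant⇒≈twistedCirculant sA) (twistedCirculant-persymmetric _)

      shiftInvariant-class : IsCommutingStarClass (IsShiftInvariant {m})
      shiftInvariant-class = record
        { +-closed         = +ₘ-shiftInvariant
        ; *-closed         = *ₘ-shiftInvariant
        ; transpose-closed = transpose-shiftInvariant
        ; conjT-closed     = conjT-shiftInvariant
        ; *ₘ-comm          = λ sA sB → persymmetric-*ₘ-comm (shiftInvariant-persymmetric sA)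
            (shiftInvariant-persymmetric sB) (shiftInvariant-persymmetric (*ₘ-shiftInvariant sA sB))
        }

    module _ (g : Carrier → Carrier) (g≈ε* : ∀ x → g x ≈ ε * x) where
      circulantWith⇒shiftInvariant : ∀ {m} {A : Mat (suc m) (suc m)} →
        IsCirculantWith g A → IsShiftInvariant A
      circulantWith⇒shiftInvariant {m} {A} (v , cA) =
        shiftInvariant-resp A≈ (twistedCirculant-shiftInvariant v)
        where
        A≈ : A ≈ₘ twistedCirculant v
        A≈ i j with toℕ i ≤? toℕ j
        ... | yes i≤j = proj₁ (cA i j) i≤j
        ... | no i≰j  = trans (proj₂ (cA i j) i≰j) (g≈ε* _)

      shiftInvariant⇒circulantWith : ∀ {m} {A : Mat (suc m) (suc m)} →
        IsShiftInvariant A → IsCirculantWith g A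
      shiftInvariant⇒circulantWith {m} {A} sA = firstRow A , λ i j →
          (λ i≤j → trans (A≈ i j) (reflexive (twistedEntry-≤ (firstRow A) i≤j)))
        , (λ i≰j → trans (A≈ i j) (trans (reflexive (twistedEntry-≰ (firstRow A) i≰j)) (sym (g≈ε* _))))
        where
        A≈ = shiftInvariant⇒≈twistedCirculant sA

      circulantWith-class : ∀ n → IsCommutingStarClass (IsCirculantWith {n} g)
      circulantWith-class zero = record
        { +-closed         = λ _ _ → vacuous
        ; *-closed         = λ _ _ → vacuous
        ; transpose-closed = λ _ → vacuous
        ; conjT-closed     = λ _ → vacuous
        ; *ₘ-comm          = λ _ _ ()
        }
        where
        vacuous : ∀ {A : Mat 0 0} → IsCirculantWith g A
        vacuous = (λ _ → 0#) , λ ()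
      circulantWith-class (suc m) = commutingStarClass-⇔
        shiftInvariant⇒circulantWith circulantWith⇒shiftInvariant shiftInvariant-class

  private
    module RingProps = RingProperties ring

  circulant-class : ∀ n → IsCommutingStarClass (IsCirculant {n})
  circulant-class =
    Twisted.circulantWith-class 1# (*-identityˡ 1#) conj-1 id (λ x → sym (*-identityˡ x))

  negacirculant-class : ∀ n → IsCommutingStarClass (IsNegacirculant {n})
  negacirculant-class = Twisted.circulantWith-class (- 1#)
    (trans (RingProps.-1*x≈-x (- 1#)) (+-Group.⁻¹-involutive 1#))
    (trans (conj-neg 1#) (-‿cong conj-1))
    -_ (λ x → sym (RingProps.-1*x≈-x x))

proposition4p4 : ∀ {c ℓ : Level} (R : StarCommRing c ℓ) (n : ℕ) →
    let open Matrices R in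
      IsStarClosed (InSD n) × IsStarClosed (InPD n)
proposition4p4 R n =
  inBlockForm-starClosed (circulant-class n) , inBlockForm-starClosed (negacirculant-class n)
  where open StarMatrices R
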